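{- Let $k\geq 2$ be an integer and let $K\geq 2$ be a constant. If $A\subseteq[n]^k$ has size $|A|\geq K\cdot c_k(n)$, then $\Gamma_k(A)\geq \left(\frac{K}{2}\right)^{k+1}\cdot c_k(n)$.
   Context: $[n]=\{1,\dots,n\}$. A $k$-dimensional corner in $[n]^k$ is a set of the form $\{\mathbf{a}\}\cup\{\mathbf{a}+de_i:1\le i\le k\}\subseteq[n]^k$ with $\mathbf{a}\in[n]^k$, $d>0$ an integer, and $e_1,\dots,e_k$ the standard basis vectors. $c_k(n)$ is the maximum size of a subset of $[n]^k$ containing no $k$-dimensional corner. $\Gamma_k(A)$ denotes the number of $k$-dimensional corners contained in $A$.
   Formalization: The constant K ≥ 2 ranges over the rationals. -}

module Defs where

open import Data.Nat as ℕ using (ℕ; zero; suc; _≤_; _<_)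
open import Data.Fin using (Fin)
open import Data.Fin.Properties using (all?)
open import Data.Vec using (Vec; _[_]%=_)
import Data.Vec.Properties as VecP
import Data.Vec.Relation.Unary.All as VAll
open import Data.List using (List; length; filter; cartesianProduct; applyUpTo)
open import Data.List.Relation.Unary.All using (All)
open import Data.List.Relation.Unary.Unique.Propositional using (Unique)
open import Data.Product using (_×_; _,_; ∃; ∃-syntax; proj₁; proj₂)
open import Relation.Nullary using (¬_; Dec; _×-dec_)
open import Relation.Binary.PropositionalEquality using (_≡_)
open import Data.Rational as ℚ using (ℚ; 1ℚ)

Point : ℕ → Set
Point k = Vec ℕ k

InGrid : ∀ {k} → ℕ → Point k → Set
InGrid n a = VAll.All (λ x → 1 ≤ x × x ≤ n) a

IsSubsetOfGrid : (k n : ℕ) → List (Point k) → Set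
IsSubsetOfGrid k n A = Unique A × All (InGrid n) A

shift : ∀ {k} → Point k → ℕ → Fin k → Point k
shift a d i = a [ i ]%= (ℕ._+ d)

import Data.List.Membership.DecPropositional as DecMem

module _ {k : ℕ} where
  open DecMem (VecP.≡-dec {A = ℕ} {n = k} ℕ._≟_) public using (_∈_; _∈?_)

-- (a , d) determines the corner {a} ∪ {a + d e_i : i}, contained in A.
IsCornerIn : ∀ {k} → List (Point k) → Point k × ℕ → Set
IsCornerIn A (a , d) = (0 < d) × (a ∈ A) × (∀ i → shift a d i ∈ A)

isCornerIn? : ∀ {k} (A : List (Point k)) (ad : Point k × ℕ) → Dec (IsCornerIn A ad)
isCornerIn? A (a , d) = (0 ℕ.<? d) ×-dec ((a ∈? A) ×-dec all? (λ i → shift a d i ∈? A))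

-- Γ_k(A) : the number of k-dimensional corners contained in A ⊆ [n]^k.
-- A corner is determined by its base point a ∈ A and its size d, with 1 ≤ d ≤ n.
Γ : ∀ {k} (n : ℕ) → List (Point k) → ℕ
Γ n A = length (filter (isCornerIn? A) (cartesianProduct A (applyUpTo suc n)))

CornerFree : ∀ {k} → List (Point k) → Set
CornerFree A = ¬ (∃ λ ad → IsCornerIn A ad)

IsCk : (k n c : ℕ) → Set
IsCk k n c =
  (∃[ A ] (IsSubsetOfGrid k n A × CornerFree A × length A ≡ c))
  × (∀ A → IsSubsetOfGrid k n A → CornerFree A → length A ≤ c)

_^ℚ_ : ℚ → ℕ → ℚ
x ^ℚ zero = 1ℚ
x ^ℚ suc m = x ℚ.* (x ^ℚ m)

ℕ→ℚ : ℕ → ℚ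
ℕ→ℚ m = ℤ.+ m ℚ./ 1
  where import Data.Integer as ℤ

-- Removing a point x from A destroys at least the m_x corners through x, and
-- Σ_{x ∈ A} m_x ≥ (k+1) Γ(A) since every corner has k+1 distinct points; averaging over x
-- gives Σ_{x ∈ A} Γ(A ∖ x) ≤ (|A| − k − 1) Γ(A). At |A| = 2c the greedy bound |A| ≤ Γ(A) + c
-- (delete base points of corners until none is left) gives Γ(A) ≥ c, and from there induction
-- on |A| yields Γ(A) ≥ c (|A| / 2c)^(k+1), the step being Bernoulli's inequality
-- (1 − 1/|A|)^(k+1) ≥ 1 − (k+1)/|A|.
module Submission where

open import Defs hiding (_∈_)

module Supersaturation where

  open import Data.Nat as ℕ using (ℕ; zero; suc; _+_; _*_; _^_; _≤_; _<_; z≤n; s≤s; NonZero)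
  open import Data.Nat.Properties
  open import Data.Nat.ListAction using (sum)
  open import Data.Nat.Solver using (module +-*-Solver)
  open import Algebra.Properties.CommutativeSemigroup +-commutativeSemigroup
    using () renaming (interchange to +-interchange)
  open import Data.Nat.Coprimality using (1-coprimeTo) renaming (sym to coprime-sym)
  import Data.Integer as ℤ
  import Data.Integer.Properties as ℤ
  open import Data.Rational as ℚ using (ℚ; mkℚ; ½; 0ℚ; 1ℚ)
  import Data.Rational.Properties as ℚ
  import Data.Fin as Fin
  import Data.Vec as Vec
  open Vec using (_∷_)
  import Data.Vec.Properties as VecP
  open import Data.Vec.Relation.Unary.All using (_∷_)
  open import Data.List
    using (List; []; _∷_; [_]; _++_; length; filter; map; tabulate; cartesianProduct; applyUpTo)
  open import Data.List.Properties
    using (length-++; length-tabulate; map-cong; filter-++; filter-all; filter-notAll; filter-some)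
  open import Data.List.Membership.Propositional using (_∈_; lose)
  open import Data.List.Relation.Binary.Subset.Propositional using (_⊆_)
  open import Data.List.Membership.Propositional.Properties
    using (∈-filter⁺; ∈-filter⁻; ∈-tabulate⁻; ∈-cartesianProduct⁺; ∈-cartesianProduct⁻; ∈-applyUpTo⁺)
  open import Data.List.Relation.Unary.Any using (here; there)
  open import Data.List.Relation.Unary.All using (All)
  import Data.List.Relation.Unary.All as All
  import Data.List.Relation.Unary.All.Properties as All
  open import Data.List.Relation.Unary.AllPairs using (_∷_)
  open import Data.List.Relation.Unary.Unique.Propositional using (Unique)
  import Data.List.Relation.Unary.Unique.Propositional.Properties as Unique
  open import Data.Product using (_×_; _,_; proj₁; proj₂)
  open import Data.Empty using (⊥; ⊥-elim)
  open import Function using (_∘_; _$_)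
  open import Level using (0ℓ)
  open import Relation.Nullary using (Dec; yes; no; ¬?; contradiction)
  open import Relation.Unary using (Pred; Decidable)
  open import Relation.Binary using (DecidableEquality)
  open import Relation.Binary.PropositionalEquality hiding ([_])

  count : {A : Set} {P : Pred A 0ℓ} → Decidable P → List A → ℕ
  count P? xs = length (filter P? xs)

  module _ {A : Set} {P : Pred A 0ℓ} (P? : Decidable P) where

    count-++ : ∀ xs ys → count P? (xs ++ ys) ≡ count P? xs + count P? ys
    count-++ xs ys = trans (cong length (filter-++ P? xs ys)) (length-++ (filter P? xs))

  module _ {A : Set} {P Q : Pred A 0ℓ} (P? : Decidable P) (Q? : Decidable Q) where

    count-filter : (∀ {x} → P x → Q x) → ∀ xs → count P? (filter Q? xs) ≡ count P? xs
    count-filter P⇒Q [] = refl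
    count-filter P⇒Q (x ∷ xs) with Q? x
    ... | yes _ with P? x
    ...   | yes _ = cong suc (count-filter P⇒Q xs)
    ...   | no _ = count-filter P⇒Q xs
    count-filter P⇒Q (x ∷ xs) | no ¬q with P? x
    ...   | yes p = ⊥-elim (¬q (P⇒Q p))
    ...   | no _ = count-filter P⇒Q xs

    count-disjoint : (∀ {x} → P x → Q x → ⊥) → ∀ xs → count P? xs + count Q? xs ≤ length xs
    count-disjoint disjoint [] = z≤n
    count-disjoint disjoint (x ∷ xs) with ih ← count-disjoint disjoint xs | P? x | Q? x
    ... | yes p | yes q = ⊥-elim (disjoint p q)
    ... | yes _ | no _ = s≤s ih
    ... | no _ | yes _ = subst (_≤ suc (length xs)) (sym (+-suc _ _)) (s≤s ih)
    ... | no _ | no _ = m≤n⇒m≤1+n ih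

  module _ {A B : Set} {P : Pred A 0ℓ} {R : Pred (A × B) 0ℓ} (P? : Decidable P) (R? : Decidable R) where

    count-cartesianProduct-filter : ∀ xs (ys : List B) →
      count R? (cartesianProduct (filter P? xs) ys) ≤ count R? (cartesianProduct xs ys)
    count-cartesianProduct-filter [] ys = z≤n
    count-cartesianProduct-filter (x ∷ xs) ys
      with ih ← count-cartesianProduct-filter xs ys | P? x
    ... | yes _ = subst₂ _≤_ (sym (count-++ R? row _)) (sym (count-++ R? row _)) (+-monoʳ-≤ _ ih)
      where row = map (x ,_) ys
    ... | no _ = subst (_ ≤_) (sym (count-++ R? (map (x ,_) ys) _)) (≤-trans ih (m≤n+m _ _))

  module _ {A : Set} where

    sum-map-+ : ∀ (f g : A → ℕ) xs → sum (map (λ x → f x + g x) xs) ≡ sum (map f xs) + sum (map g xs)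
    sum-map-+ f g [] = refl
    sum-map-+ f g (x ∷ xs) = trans (cong ((f x + g x) +_) (sum-map-+ f g xs)) (+-interchange (f x) (g x) _ _)

    sum-map-mono : ∀ (f g : A → ℕ) xs → (∀ {x} → x ∈ xs → f x ≤ g x) → sum (map f xs) ≤ sum (map g xs)
    sum-map-mono f g [] f≤g = z≤n
    sum-map-mono f g (x ∷ xs) f≤g = +-mono-≤ (f≤g (here refl)) (sum-map-mono f g xs (f≤g ∘ there))

    sum-map-const : ∀ m (xs : List A) → sum (map (λ _ → m) xs) ≡ length xs * m
    sum-map-const m [] = refl
    sum-map-const m (x ∷ xs) = cong (m +_) (sum-map-const m xs)

    sum-map-*ʳ : ∀ (f : A → ℕ) m xs → sum (map (λ x → f x * m) xs) ≡ sum (map f xs) * m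
    sum-map-*ʳ f m [] = refl
    sum-map-*ʳ f m (x ∷ xs) =
      trans (cong (f x * m +_) (sum-map-*ʳ f m xs)) (sym (*-distribʳ-+ m (f x) (sum (map f xs))))

  module _ {A B : Set} {R : A → B → Set} (R? : ∀ x y → Dec (R x y)) where

    sum-count-swap : ∀ xs ys →
      sum (map (λ x → count (R? x) ys) xs) ≡ sum (map (λ y → count (λ x → R? x y) xs) ys)
    sum-count-swap [] ys = sym (trans (sum-map-const 0 ys) (*-zeroʳ (length ys)))
    sum-count-swap (a ∷ xs) ys = begin
      count (R? a) ys + sum (map (λ x → count (R? x) ys) xs)
        ≡⟨ cong₂ _+_ (count-as-sum ys) (sum-count-swap xs ys) ⟩
      sum (map (λ y → count (R? a) [ y ]) ys) + sum (map (λ y → count (λ x → R? x y) xs) ys)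
        ≡⟨ sym (sum-map-+ _ _ ys) ⟩
      sum (map (λ y → count (R? a) [ y ] + count (λ x → R? x y) xs) ys)
        ≡⟨ cong sum (map-cong count-∷-swap ys) ⟩
      sum (map (λ y → count (λ x → R? x y) (a ∷ xs)) ys) ∎
      where
      open ≡-Reasoning
      count-as-sum : ∀ zs → count (R? a) zs ≡ sum (map (λ y → count (R? a) [ y ]) zs)
      count-as-sum [] = refl
      count-as-sum (z ∷ zs) =
        trans (count-++ (R? a) [ z ] zs) (cong (count (R? a) [ z ] +_) (count-as-sum zs))
      singleton-swap : ∀ y → count (R? a) [ y ] ≡ count (λ x → R? x y) [ a ]
      singleton-swap y with R? a y
      ... | yes _ = refl
      ... | no _ = refl
      count-∷-swap : ∀ y → count (R? a) [ y ] + count (λ x → R? x y) xs ≡ count (λ x → R? x y) (a ∷ xs)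
      count-∷-swap y = trans (cong (_+ _) (singleton-swap y)) (sym (count-++ (λ x → R? x y) [ a ] xs))

  module _ {A : Set} (_≟_ : DecidableEquality A) where

    remove : A → List A → List A
    remove x = filter (λ y → ¬? (y ≟ x))

    x∉remove : ∀ {x} xs → x ∈ remove x xs → ⊥
    x∉remove {x} xs x∈ = proj₂ (∈-filter⁻ (λ y → ¬? (y ≟ x)) {xs = xs} x∈) refl

    length-remove : ∀ {x xs} → Unique xs → x ∈ xs → suc (length (remove x xs)) ≡ length xs
    length-remove {x} {y ∷ xs} (y∉xs ∷ _) (here refl) with y ≟ y
    ... | no y≢y = ⊥-elim (y≢y refl)
    ... | yes _ =
      cong (suc ∘ length) (filter-all (λ z → ¬? (z ≟ y)) (All.map (λ y≢z z≡y → y≢z (sym z≡y)) y∉xs))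
    length-remove {x} {y ∷ xs} (y∉xs ∷ xs!) (there x∈xs) with y ≟ x
    ... | yes refl = ⊥-elim (All.lookup y∉xs x∈xs refl)
    ... | no _ = cong suc (length-remove xs! x∈xs)

    unique⊆⇒length≤ : ∀ {xs ys} → Unique xs → xs ⊆ ys → length xs ≤ length ys
    unique⊆⇒length≤ {[]} _ _ = z≤n
    unique⊆⇒length≤ {x ∷ xs} {ys} (x∉xs ∷ xs!) xs⊆ys = begin-strict
      length xs            ≤⟨ unique⊆⇒length≤ xs! xs⊆ys∖x ⟩
      length (remove x ys) <⟨ filter-notAll (λ y → ¬? (y ≟ x)) ys (lose (xs⊆ys (here refl)) (_$ refl)) ⟩
      length ys            ∎
      where
      open ≤-Reasoning
      xs⊆ys∖x : xs ⊆ remove x ys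
      xs⊆ys∖x z∈xs =
        ∈-filter⁺ (λ y → ¬? (y ≟ x)) (xs⊆ys (there z∈xs)) (λ z≡x → All.lookup x∉xs z∈xs (sym z≡x))

  module _ {k : ℕ} where

    _≟ᵖ_ : DecidableEquality (Point k)
    _≟ᵖ_ = VecP.≡-dec ℕ._≟_

    _∖_ : List (Point k) → Point k → List (Point k)
    A ∖ x = remove _≟ᵖ_ x A

    cornerPoints : Point k × ℕ → List (Point k)
    cornerPoints (a , d) = a ∷ tabulate (shift a d)

    length-cornerPoints : ∀ ad → length (cornerPoints ad) ≡ suc k
    length-cornerPoints (a , d) = cong suc (length-tabulate (shift a d))

    lookup-shift-≡ : ∀ (a : Point k) d i → Vec.lookup (shift a d i) i ≡ Vec.lookup a i + d
    lookup-shift-≡ a d i = VecP.lookup∘updateAt i a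

    lookup-shift-≢ : ∀ (a : Point k) d {i j} → i ≢ j → Vec.lookup (shift a d j) i ≡ Vec.lookup a i
    lookup-shift-≢ a d {i} {j} i≢j = VecP.lookup∘updateAt′ i j i≢j a

    cornerPoints-unique : ∀ a {d} → 0 < d → Unique (cornerPoints (a , d))
    cornerPoints-unique a {d} 0<d =
      All.tabulate⁺ (λ i a≡a+dᵢ → moved i (cong (λ v → Vec.lookup v i) (sym a≡a+dᵢ)))
      ∷ Unique.tabulate⁺ shift-injective
      where
      moved : ∀ i → Vec.lookup (shift a d i) i ≢ Vec.lookup a i
      moved i eq = <-irrefl (sym (trans (sym (lookup-shift-≡ a d i)) eq)) (m<m+n (Vec.lookup a i) 0<d)
      shift-injective : ∀ {i j} → shift a d i ≡ shift a d j → i ≡ j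
      shift-injective {i} {j} eq with i Fin.≟ j
      ... | yes i≡j = i≡j
      ... | no i≢j = ⊥-elim (moved i (trans (cong (λ v → Vec.lookup v i) eq) (lookup-shift-≢ a d i≢j)))

    cornerPoints⊆ : ∀ {A ad} → IsCornerIn A ad → cornerPoints ad ⊆ A
    cornerPoints⊆ (_ , a∈A , _) (here refl) = a∈A
    cornerPoints⊆ (_ , _ , shifts∈A) (there x∈shifts) with ∈-tabulate⁻ x∈shifts
    ... | i , refl = shifts∈A i

    ∖-IsSubsetOfGrid : ∀ {n A} x → IsSubsetOfGrid k n A → IsSubsetOfGrid k n (A ∖ x)
    ∖-IsSubsetOfGrid x (unique , inGrid) = Unique.filter⁺ _ unique , All.filter⁺ _ inGrid

    IsCornerIn-∖ : ∀ {A x ad} → IsCornerIn (A ∖ x) ad → IsCornerIn A ad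
    IsCornerIn-∖ (0<d , a∈ , shifts∈) =
      0<d , proj₁ (∈-filter⁻ _ a∈) , (λ i → proj₁ (∈-filter⁻ _ (shifts∈ i)))

  module _ {k : ℕ} (n : ℕ) where

    candidates : List (Point k) → List (Point k × ℕ)
    candidates A = cartesianProduct A (applyUpTo suc n)

    -- Γ n A is definitionally length (corners A).
    corners : List (Point k) → List (Point k × ℕ)
    corners A = filter (isCornerIn? A) (candidates A)

    cornersThrough : List (Point k) → Point k → ℕ
    cornersThrough A x = count (λ ad → x ∈? cornerPoints ad) (corners A)

    Γ-∖ : ∀ A x → Γ n (A ∖ x) + cornersThrough A x ≤ Γ n A
    Γ-∖ A x = begin
      Γ n (A ∖ x) + cornersThrough A x
        ≤⟨ +-monoˡ-≤ _ (count-cartesianProduct-filter _ (isCornerIn? (A ∖ x)) A (applyUpTo suc n)) ⟩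
      count (isCornerIn? (A ∖ x)) (candidates A) + cornersThrough A x
        ≡⟨ cong (_+ cornersThrough A x) (count-filter _ (isCornerIn? A) IsCornerIn-∖ (candidates A)) ⟨
      count (isCornerIn? (A ∖ x)) (corners A) + cornersThrough A x
        ≤⟨ count-disjoint _ _ (λ corner x∈ → x∉remove _≟ᵖ_ A (cornerPoints⊆ corner x∈)) (corners A) ⟩
      Γ n A ∎
      where open ≤-Reasoning

    cornersThrough-sum : ∀ A → Γ n A * suc k ≤ sum (map (cornersThrough A) A)
    cornersThrough-sum A = begin
      Γ n A * suc k
        ≡⟨ sum-map-const (suc k) (corners A) ⟨
      sum (map (λ _ → suc k) (corners A))
        ≤⟨ sum-map-mono _ _ (corners A) (points-in-A ∘ proj₂ ∘ ∈-filter⁻ (isCornerIn? A) {xs = candidates A}) ⟩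
      sum (map (λ ad → count (_∈? cornerPoints ad) A) (corners A))
        ≡⟨ sum-count-swap (λ x ad → x ∈? cornerPoints ad) A (corners A) ⟨
      sum (map (cornersThrough A) A) ∎
      where
      open ≤-Reasoning
      points-in-A : ∀ {ad} → IsCornerIn A ad → suc k ≤ count (_∈? cornerPoints ad) A
      points-in-A {ad@(a , _)} corner = subst (_≤ count (_∈? cornerPoints ad) A) (length-cornerPoints ad)
        (unique⊆⇒length≤ _≟ᵖ_ (cornerPoints-unique a (proj₁ corner)) (λ x∈ → ∈-filter⁺ _ (cornerPoints⊆ corner x∈) x∈))

    Γ-average : ∀ A V S → (∀ {x} → x ∈ A → V ≤ Γ n (A ∖ x) * S) →
      length A * V + suc k * (Γ n A * S) ≤ length A * (Γ n A * S)
    Γ-average A V S V≤ = begin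
      length A * V + suc k * (Γ n A * S)
        ≡⟨ cong (length A * V +_) (*-comm-middle (suc k) (Γ n A) S) ⟩
      length A * V + Γ n A * suc k * S
        ≤⟨ +-monoʳ-≤ _ (*-monoˡ-≤ S (cornersThrough-sum A)) ⟩
      length A * V + sum (map (cornersThrough A) A) * S
        ≡⟨ cong₂ _+_ (sum-map-const V A) (sum-map-*ʳ (cornersThrough A) S A) ⟨
      sum (map (λ _ → V) A) + sum (map (λ x → cornersThrough A x * S) A)
        ≡⟨ sum-map-+ _ _ A ⟨
      sum (map (λ x → V + cornersThrough A x * S) A)
        ≤⟨ sum-map-mono _ _ A per-point ⟩
      sum (map (λ _ → Γ n A * S) A)
        ≡⟨ sum-map-const (Γ n A * S) A ⟩
      length A * (Γ n A * S) ∎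
      where
      open ≤-Reasoning
      *-comm-middle : ∀ a b c → a * (b * c) ≡ b * a * c
      *-comm-middle a b c = trans (sym (*-assoc a b c)) (cong (_* c) (*-comm a b))
      per-point : ∀ {x} → x ∈ A → V + cornersThrough A x * S ≤ Γ n A * S
      per-point {x} x∈A = begin
        V + cornersThrough A x * S                ≤⟨ +-monoˡ-≤ _ (V≤ x∈A) ⟩
        Γ n (A ∖ x) * S + cornersThrough A x * S  ≡⟨ *-distribʳ-+ S (Γ n (A ∖ x)) _ ⟨
        (Γ n (A ∖ x) + cornersThrough A x) * S    ≤⟨ *-monoˡ-≤ S (Γ-∖ A x) ⟩
        Γ n A * S                                 ∎

  module _ {k : ℕ} (n : ℕ) where

    -- The size d ≤ n of a corner in the grid is read off the first coordinate of a + d e₀.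
    ∈-corners⁺ : ∀ {A ad} → All (InGrid n) A → IsCornerIn {suc k} A ad → ad ∈ corners n A
    ∈-corners⁺ {A} {a , zero} _ (() , _)
    ∈-corners⁺ {A} {a@(a₀ ∷ _) , suc d-1} inGrid corner@(_ , a∈A , shifts∈A)
      with All.lookup inGrid (shifts∈A Fin.zero)
    ... | (_ , a₀+d≤n) ∷ _ = ∈-filter⁺ (isCornerIn? A)
            (∈-cartesianProduct⁺ a∈A (∈-applyUpTo⁺ suc (≤-trans (m≤n+m (suc d-1) a₀) a₀+d≤n))) corner

    length≤Γ+c : ∀ {c} → IsCk (suc k) n c → ∀ {A} → IsSubsetOfGrid (suc k) n A → length A ≤ Γ n A + c
    length≤Γ+c {c} (_ , maximal) = go _ refl
      where
      go : ∀ m {A} → length A ≡ m → IsSubsetOfGrid (suc k) n A → length A ≤ Γ n A + c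
      go zero {A} len≡ _ = subst (_≤ Γ n A + c) (sym len≡) z≤n
      go (suc m) {A} len≡ sub@(unique , inGrid) = by-corners (corners n A) refl
        where
        by-corners : ∀ cs → corners n A ≡ cs → length A ≤ Γ n A + c
        by-corners [] corners≡ = ≤-trans (maximal A sub cornerFree) (m≤n+m c (Γ n A))
          where
          cornerFree : CornerFree A
          cornerFree (ad , corner) with () ← subst (ad ∈_) corners≡ (∈-corners⁺ inGrid corner)
        by-corners ((a , d) ∷ _) corners≡ = begin
          length A                                ≡⟨ length-remove _≟ᵖ_ unique a∈A ⟨
          suc (length (A ∖ a))                    ≤⟨ s≤s (go m |A∖a|≡m (∖-IsSubsetOfGrid a sub)) ⟩
          suc (Γ n (A ∖ a) + c)                   ≡⟨ cong (_+ c) (+-comm 1 (Γ n (A ∖ a))) ⟩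
          Γ n (A ∖ a) + 1 + c                     ≤⟨ +-monoˡ-≤ c (+-monoʳ-≤ _ through-a) ⟩
          Γ n (A ∖ a) + cornersThrough n A a + c  ≤⟨ +-monoˡ-≤ c (Γ-∖ n A a) ⟩
          Γ n A + c                               ∎
          where
          open ≤-Reasoning
          ad∈corners : (a , d) ∈ corners n A
          ad∈corners = subst ((a , d) ∈_) (sym corners≡) (here refl)
          a∈A : a ∈ A
          a∈A = proj₁ (∈-cartesianProduct⁻ A (applyUpTo suc n) (proj₁ (∈-filter⁻ (isCornerIn? A) ad∈corners)))
          |A∖a|≡m : length (A ∖ a) ≡ m
          |A∖a|≡m = suc-injective (trans (length-remove _≟ᵖ_ unique a∈A) len≡)
          through-a : 1 ≤ cornersThrough n A a
          through-a = filter-some (λ ad → a ∈? cornerPoints ad) (lose ad∈corners (here refl))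

  module _ where
    open +-*-Solver
    open ≤-Reasoning

    -- (1 − 1/(N+1))^(m+1) ≥ 1 − (m+1)/(N+1), cleared of denominators.
    bernoulli : ∀ N m → N * suc N ^ m ≤ N ^ suc m + m * suc N ^ m
    bernoulli N zero = m≤m+n (N * 1) 0
    bernoulli N (suc m) = begin
      N * (suc N * P)
        ≡⟨ solve 2 (λ N P → N :* ((con 1 :+ N) :* P) := N :* (N :* P) :+ N :* P) refl N P ⟩
      N * (N * P) + N * P
        ≤⟨ +-monoˡ-≤ (N * P) (*-monoʳ-≤ N (bernoulli N m)) ⟩
      N * (Q + m * P) + N * P
        ≡⟨ solve 4 (λ N P Q m → N :* (Q :+ m :* P) :+ N :* P := N :* Q :+ (con 1 :+ m) :* (N :* P)) refl N P Q m ⟩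
      N * Q + suc m * (N * P)
        ≤⟨ +-monoʳ-≤ (N * Q) (*-monoʳ-≤ (suc m) (*-monoˡ-≤ P (n≤1+n N))) ⟩
      N * Q + suc m * (suc N * P) ∎
      where
      P = suc N ^ m
      Q = N ^ suc m

    cancel-weights : ∀ a s T X → suc (a + s) * T + suc a * X ≤ a * T + suc (suc (a + s)) * X → T ≤ X
    cancel-weights a s T X weighted = *-cancelˡ-≤ (suc s) (+-cancelˡ-≤ (a * T + suc a * X) _ _ (begin
      a * T + suc a * X + suc s * T
        ≡⟨ solve 4 (λ a s T X → a :* T :+ (con 1 :+ a) :* X :+ (con 1 :+ s) :* T
                              := (con 1 :+ (a :+ s)) :* T :+ (con 1 :+ a) :* X) refl a s T X ⟩
      suc (a + s) * T + suc a * X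
        ≤⟨ weighted ⟩
      a * T + suc (suc (a + s)) * X
        ≡⟨ solve 4 (λ a s T X → a :* T :+ (con 2 :+ (a :+ s)) :* X
                              := a :* T :+ (con 1 :+ a) :* X :+ (con 1 :+ s) :* X) refl a s T X ⟩
      a * T + suc a * X + suc s * X ∎))

    averaged⇒power-bound : ∀ N k C X → 1 ≤ C → 1 ≤ N →
      suc N * (C * N ^ suc k) + suc k * X ≤ suc N * X → C * suc N ^ suc k ≤ X
    averaged⇒power-bound N k C X 1≤C 1≤N averaged with k <? N
    ... | no k≮N = contradiction Z≤0 (<⇒≱ 0<Z)
      where
      Z = suc N * (C * N ^ suc k)
      0<Z : 0 < Z
      0<Z = *-mono-≤ {1} {suc N} (s≤s z≤n) (*-mono-≤ 1≤C (m^n>0 N {{ℕ.>-nonZero 1≤N}} (suc k)))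
      Z≤0 : Z ≤ 0
      Z≤0 = +-cancelʳ-≤ (suc k * X) Z 0 (≤-trans averaged (*-monoˡ-≤ X (s≤s (≮⇒≥ k≮N))))
    ... | yes k<N with s , refl ← m≤n⇒∃[o]m+o≡n k<N = cancel-weights k s T X (begin
      suc (k + s) * T + suc k * X
        ≤⟨ +-monoˡ-≤ (suc k * X) bernoulli-scaled ⟩
      Z + k * T + suc k * X
        ≡⟨ solve 4 (λ Z k T X → Z :+ k :* T :+ (con 1 :+ k) :* X := k :* T :+ (Z :+ (con 1 :+ k) :* X)) refl Z k T X ⟩
      k * T + (Z + suc k * X)
        ≤⟨ +-monoʳ-≤ (k * T) averaged ⟩
      k * T + suc (suc (k + s)) * X ∎)
      where
      T = C * suc N ^ suc k
      Z = suc N * (C * N ^ suc k)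
      P = suc N ^ k
      bernoulli-scaled : N * T ≤ Z + k * T
      bernoulli-scaled = begin
        N * T
          ≡⟨ solve 3 (λ N C P → N :* (C :* ((con 1 :+ N) :* P)) := (C :* (con 1 :+ N)) :* (N :* P)) refl N C P ⟩
        (C * suc N) * (N * P)
          ≤⟨ *-monoʳ-≤ (C * suc N) (bernoulli N k) ⟩
        (C * suc N) * (N ^ suc k + k * P)
          ≡⟨ solve 5 (λ N C P Q k → (C :* (con 1 :+ N)) :* (Q :+ k :* P)
                                 := (con 1 :+ N) :* (C :* Q) :+ k :* (C :* ((con 1 :+ N) :* P))) refl N C P (N ^ suc k) k ⟩
        Z + k * T ∎

  ℕ→ℚ-mkℚ : ∀ m → ℕ→ℚ m ≡ mkℚ (ℤ.+ m) 0 (coprime-sym (1-coprimeTo m))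
  ℕ→ℚ-mkℚ m = ℚ.normalize-coprime (coprime-sym (1-coprimeTo m))

  ℕ→ℚ-* : ∀ m n → ℕ→ℚ (m * n) ≡ ℕ→ℚ m ℚ.* ℕ→ℚ n
  ℕ→ℚ-* m n rewrite ℕ→ℚ-mkℚ m | ℕ→ℚ-mkℚ n = cong (ℚ._/ 1) (ℤ.pos-* m n)

  ℕ→ℚ-^ : ∀ m e → ℕ→ℚ (m ^ e) ≡ ℕ→ℚ m ^ℚ e
  ℕ→ℚ-^ m zero = refl
  ℕ→ℚ-^ m (suc e) = trans (ℕ→ℚ-* m (m ^ e)) (cong (ℕ→ℚ m ℚ.*_) (ℕ→ℚ-^ m e))

  ℕ→ℚ-mono-≤ : ∀ {m n} → m ≤ n → ℕ→ℚ m ℚ.≤ ℕ→ℚ n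
  ℕ→ℚ-mono-≤ {m} {n} m≤n rewrite ℕ→ℚ-mkℚ m | ℕ→ℚ-mkℚ n = ℚ.*≤* (ℤ.*-monoʳ-≤-nonNeg (ℤ.+ 1) (ℤ.+≤+ m≤n))

  ℕ→ℚ-cancel-≤ : ∀ {m n} → ℕ→ℚ m ℚ.≤ ℕ→ℚ n → m ≤ n
  ℕ→ℚ-cancel-≤ {m} {n} le rewrite ℕ→ℚ-mkℚ m | ℕ→ℚ-mkℚ n with ℚ.*≤* le′ ← le =
    ℤ.drop‿+≤+ (ℤ.*-cancelʳ-≤-pos _ _ (ℤ.+ 1) le′)

  ℕ→ℚ-pos : ∀ m .{{_ : NonZero m}} → ℚ.Positive (ℕ→ℚ m)
  ℕ→ℚ-pos (suc m) rewrite ℕ→ℚ-mkℚ (suc m) = _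

  ℕ→ℚ-nonNeg : ∀ m → ℚ.NonNegative (ℕ→ℚ m)
  ℕ→ℚ-nonNeg m = ℚ.nonNegative (ℕ→ℚ-mono-≤ (z≤n {m}))

  ^ℚ-nonNeg : ∀ x e → 0ℚ ℚ.≤ x → 0ℚ ℚ.≤ x ^ℚ e
  ^ℚ-nonNeg x zero 0≤x = ℚ.*≤* (ℤ.+≤+ z≤n)
  ^ℚ-nonNeg x (suc e) 0≤x =
    ℚ.nonNegative⁻¹ _ {{ℚ.nonNeg*nonNeg⇒nonNeg x {{ℚ.nonNegative 0≤x}} _ {{ℚ.nonNegative (^ℚ-nonNeg x e 0≤x)}}}}

  ^ℚ-monoˡ-≤ : ∀ {x y} e → 0ℚ ℚ.≤ x → x ℚ.≤ y → x ^ℚ e ℚ.≤ y ^ℚ e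
  ^ℚ-monoˡ-≤ zero 0≤x x≤y = ℚ.≤-refl
  ^ℚ-monoˡ-≤ {x} {y} (suc e) 0≤x x≤y = ℚ.≤-trans
    (ℚ.*-monoʳ-≤-nonNeg (x ^ℚ e) {{ℚ.nonNegative (^ℚ-nonNeg x e 0≤x)}} x≤y)
    (ℚ.*-monoˡ-≤-nonNeg y {{ℚ.nonNegative (ℚ.≤-trans 0≤x x≤y)}} (^ℚ-monoˡ-≤ e 0≤x x≤y))

  ^ℚ-distribʳ-* : ∀ x y e → (x ℚ.* y) ^ℚ e ≡ x ^ℚ e ℚ.* y ^ℚ e
  ^ℚ-distribʳ-* x y zero = refl
  ^ℚ-distribʳ-* x y (suc e) = begin
    (x ℚ.* y) ℚ.* (x ℚ.* y) ^ℚ e      ≡⟨ cong ((x ℚ.* y) ℚ.*_) (^ℚ-distribʳ-* x y e) ⟩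
    (x ℚ.* y) ℚ.* (xᵉ ℚ.* yᵉ)         ≡⟨ ℚ.*-assoc x y _ ⟩
    x ℚ.* (y ℚ.* (xᵉ ℚ.* yᵉ))         ≡⟨ cong (x ℚ.*_) (ℚ.*-assoc y xᵉ yᵉ) ⟨
    x ℚ.* ((y ℚ.* xᵉ) ℚ.* yᵉ)         ≡⟨ cong (λ z → x ℚ.* (z ℚ.* yᵉ)) (ℚ.*-comm y xᵉ) ⟩
    x ℚ.* ((xᵉ ℚ.* y) ℚ.* yᵉ)         ≡⟨ cong (x ℚ.*_) (ℚ.*-assoc xᵉ y yᵉ) ⟩
    x ℚ.* (xᵉ ℚ.* (y ℚ.* yᵉ))         ≡⟨ ℚ.*-assoc x xᵉ _ ⟨
    (x ℚ.* xᵉ) ℚ.* (y ℚ.* yᵉ)         ∎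
    where
    open ≡-Reasoning
    xᵉ = x ^ℚ e
    yᵉ = y ^ℚ e

  rescale-bound : ∀ e C N G D .{{_ : NonZero D}} (q : ℚ) → 0ℚ ℚ.≤ q →
    q ℚ.* ℕ→ℚ D ℚ.≤ ℕ→ℚ N → C * N ^ e ≤ G * D ^ e → q ^ℚ e ℚ.* ℕ→ℚ C ℚ.≤ ℕ→ℚ G
  rescale-bound e C N G D q 0≤q qD≤N bound = ℚ.*-cancelʳ-≤-pos (d ^ℚ e) {{dᵉ-pos}} (begin
    q ^ℚ e ℚ.* c ℚ.* d ^ℚ e     ≡⟨ cong (ℚ._* d ^ℚ e) (ℚ.*-comm (q ^ℚ e) c) ⟩
    c ℚ.* q ^ℚ e ℚ.* d ^ℚ e     ≡⟨ ℚ.*-assoc c _ _ ⟩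
    c ℚ.* (q ^ℚ e ℚ.* d ^ℚ e)   ≡⟨ cong (c ℚ.*_) (^ℚ-distribʳ-* q d e) ⟨
    c ℚ.* (q ℚ.* d) ^ℚ e        ≤⟨ ℚ.*-monoˡ-≤-nonNeg c {{ℕ→ℚ-nonNeg C}} (^ℚ-monoˡ-≤ e 0≤qd qD≤N) ⟩
    c ℚ.* ℕ→ℚ N ^ℚ e            ≡⟨ trans (ℕ→ℚ-* C (N ^ e)) (cong (c ℚ.*_) (ℕ→ℚ-^ N e)) ⟨
    ℕ→ℚ (C * N ^ e)             ≤⟨ ℕ→ℚ-mono-≤ bound ⟩
    ℕ→ℚ (G * D ^ e)             ≡⟨ trans (ℕ→ℚ-* G (D ^ e)) (cong (ℕ→ℚ G ℚ.*_) (ℕ→ℚ-^ D e)) ⟩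
    ℕ→ℚ G ℚ.* d ^ℚ e            ∎)
    where
    open ℚ.≤-Reasoning
    c = ℕ→ℚ C
    d = ℕ→ℚ D
    dᵉ-pos : ℚ.Positive (d ^ℚ e)
    dᵉ-pos = subst ℚ.Positive (ℕ→ℚ-^ D e) (ℕ→ℚ-pos (D ^ e) {{m^n≢0 D e}})
    0≤qd : 0ℚ ℚ.≤ q ℚ.* d
    0≤qd = ℚ.nonNegative⁻¹ _ {{ℚ.nonNeg*nonNeg⇒nonNeg q {{ℚ.nonNegative 0≤q}} d {{ℕ→ℚ-nonNeg D}}}}

  module _ {k : ℕ} (n : ℕ) {c : ℕ} (isCk : IsCk (suc k) n (suc c)) where

    Saturated : List (Point (suc k)) → ℕ → Set
    Saturated A m = suc c * m ^ suc (suc k) ≤ Γ n A * (2 * suc c) ^ suc (suc k)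

    supersaturation-excess : ∀ j {A} → IsSubsetOfGrid (suc k) n A → length A ≡ 2 * suc c + j → Saturated A (length A)
    supersaturation-excess zero {A} sub len≡ = subst (Saturated A) (sym |A|≡2c) (*-monoˡ-≤ _ c≤Γ)
      where
      |A|≡2c : length A ≡ 2 * suc c
      |A|≡2c = trans len≡ (+-identityʳ _)
      c≤Γ : suc c ≤ Γ n A
      c≤Γ = +-cancelʳ-≤ (suc c) (suc c) (Γ n A)
        (subst (_≤ Γ n A + suc c) (trans |A|≡2c (cong (suc c +_) (+-identityʳ (suc c)))) (length≤Γ+c n isCk sub))
    supersaturation-excess (suc j) {A} sub len≡ = subst (Saturated A) (sym |A|≡1+N)
      (averaged⇒power-bound N (suc k) (suc c) X (s≤s z≤n) (s≤s z≤n)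
        (subst (λ m → m * (suc c * N ^ suc (suc k)) + suc (suc k) * X ≤ m * X) |A|≡1+N
          (Γ-average n A _ _ removal-bound)))
      where
      X = Γ n A * (2 * suc c) ^ suc (suc k)
      N = 2 * suc c + j
      |A|≡1+N : length A ≡ suc N
      |A|≡1+N = trans len≡ (+-suc (2 * suc c) j)
      removal-bound : ∀ {x} → x ∈ A → Saturated (A ∖ x) N
      removal-bound {x} x∈A = subst (Saturated (A ∖ x)) |A∖x|≡N (supersaturation-excess j (∖-IsSubsetOfGrid x sub) |A∖x|≡N)
        where
        |A∖x|≡N : length (A ∖ x) ≡ N
        |A∖x|≡N = suc-injective (trans (length-remove _≟ᵖ_ (proj₁ sub) x∈A) |A|≡1+N)

    supersaturation : ∀ {A} → IsSubsetOfGrid (suc k) n A → 2 * suc c ≤ length A → Saturated A (length A)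
    supersaturation sub 2c≤|A| with j , 2c+j≡|A| ← m≤n⇒∃[o]m+o≡n 2c≤|A| = supersaturation-excess j sub (sym 2c+j≡|A|)

  supersaturation-ℚ : ∀ {k} n {c} → IsCk (suc k) n (suc c) → ∀ {A} → IsSubsetOfGrid (suc k) n A →
    ∀ K → ℕ→ℚ 2 ℚ.≤ K → K ℚ.* ℕ→ℚ (suc c) ℚ.≤ ℕ→ℚ (length A) →
    (K ℚ.* ½) ^ℚ suc (suc k) ℚ.* ℕ→ℚ (suc c) ℚ.≤ ℕ→ℚ (Γ n A)
  supersaturation-ℚ {k} n {c} isCk {A} sub K 2≤K Kc≤|A| =
    rescale-bound (suc (suc k)) (suc c) (length A) (Γ n A) (2 * suc c) (K ℚ.* ½) 0≤K/2
      (subst (ℚ._≤ ℕ→ℚ (length A)) (sym K/2·2c≡Kc) Kc≤|A|) (supersaturation n isCk sub 2c≤|A|)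
    where
    0≤K/2 : 0ℚ ℚ.≤ K ℚ.* ½
    0≤K/2 = ℚ.≤-trans (ℚ.*≤* (ℤ.+≤+ z≤n)) (ℚ.*-monoʳ-≤-nonNeg ½ 2≤K)
    K/2·2c≡Kc : K ℚ.* ½ ℚ.* ℕ→ℚ (2 * suc c) ≡ K ℚ.* ℕ→ℚ (suc c)
    K/2·2c≡Kc = begin
      K ℚ.* ½ ℚ.* ℕ→ℚ (2 * suc c)            ≡⟨ cong (K ℚ.* ½ ℚ.*_) (ℕ→ℚ-* 2 (suc c)) ⟩
      K ℚ.* ½ ℚ.* (ℕ→ℚ 2 ℚ.* ℕ→ℚ (suc c))    ≡⟨ ℚ.*-assoc K ½ _ ⟩
      K ℚ.* (½ ℚ.* (ℕ→ℚ 2 ℚ.* ℕ→ℚ (suc c)))  ≡⟨ cong (K ℚ.*_) (ℚ.*-assoc ½ (ℕ→ℚ 2) (ℕ→ℚ (suc c))) ⟨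
      K ℚ.* (1ℚ ℚ.* ℕ→ℚ (suc c))             ≡⟨ cong (K ℚ.*_) (ℚ.*-identityˡ (ℕ→ℚ (suc c))) ⟩
      K ℚ.* ℕ→ℚ (suc c)                      ∎
      where open ≡-Reasoning
    2c≤|A| : 2 * suc c ≤ length A
    2c≤|A| = ℕ→ℚ-cancel-≤ (ℚ.≤-trans (ℚ.≤-reflexive (ℕ→ℚ-* 2 (suc c)))
      (ℚ.≤-trans (ℚ.*-monoʳ-≤-nonNeg (ℕ→ℚ (suc c)) {{ℕ→ℚ-nonNeg (suc c)}} 2≤K) Kc≤|A|))

open Supersaturation using (supersaturation-ℚ; ℕ→ℚ-mono-≤)
open import Data.Nat using (ℕ; zero; suc; _≤_; _+_; z≤n)
open import Data.Nat.Properties using (+-comm)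
open import Data.List using (List; length)
open import Data.Rational using (ℚ; _*_; ½)
open import Data.Rational using () renaming (_≤_ to _≤ℚ_)
open import Data.Rational.Properties using (*-zeroʳ)
open import Relation.Binary.PropositionalEquality using (sym; subst)

lemma2 : ∀ (k : ℕ) → 2 ≤ k → ∀ (K : ℚ) → ℕ→ℚ 2 ≤ℚ K →
    ∀ (n c : ℕ) → IsCk k n c →
    ∀ (A : List (Point k)) → IsSubsetOfGrid k n A →
    K * ℕ→ℚ c ≤ℚ ℕ→ℚ (length A) →
    ((K * ½) ^ℚ (k + 1)) * ℕ→ℚ c ≤ℚ ℕ→ℚ (Γ n A)
lemma2 (suc k) _ K _ n zero _ A _ _ =
  subst (_≤ℚ ℕ→ℚ (Γ n A)) (sym (*-zeroʳ ((K * ½) ^ℚ (suc k + 1)))) (ℕ→ℚ-mono-≤ (z≤n {Γ n A}))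
lemma2 (suc k) _ K 2≤K n (suc c) isCk A sub Kc≤|A| =
  subst (λ e → (K * ½) ^ℚ e * ℕ→ℚ (suc c) ≤ℚ ℕ→ℚ (Γ n A)) (+-comm 1 (suc k))
    (supersaturation-ℚ n isCk sub K 2≤K Kc≤|A|)
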